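{- For positive integers $n,k,t$ with $k,t\le n$, \[t\left[{n\atop k/t}\right]=\sum_{j=1}^n\binom{n}{j}(j-1)!\left[{n-j\atop k/t-1}\right].\]
   Context: For integers $m\ge0$, $k\ge1$, $t\ge0$, a mixed coloured permutation of $[m]=\{1,\ldots,m\}$ is a permutation of $[m]$ together with a colouring of its cycles with colours from $\{1,\ldots,k\}$ such that exactly $t$ cycles receive colour $1$ (the special colour) and each of the colours $2,\ldots,k$ is used on exactly one cycle (for $m=0$ the count is $1$ if $t+k-1=0$, else $0$); $\left[{m\atop k/t}\right]$ denotes their number. -}

module Defs where

open import Data.Nat using (ℕ; zero; suc; _+_; _≤ᵇ_; _≡ᵇ_)
open import Data.Bool using (Bool; true; false; _∧_; not; if_then_else_)
import Data.Fin as Fin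
open Fin using (Fin; toℕ)
open import Data.Fin.Properties using (_≟_)
open import Data.Vec using (Vec; []; _∷_; lookup)
open import Data.List using (List; []; _∷_; map; concatMap; filter; length; allFin; upTo; sum; cartesianProduct)
open import Data.Product using (_×_; _,_; proj₁; proj₂)
open import Relation.Nullary.Decidable using (⌊_⌋)
open import Relation.Unary using (Decidable)
open import Function using (_∘_)
open import Relation.Binary.PropositionalEquality using (_≡_)
open import Relation.Nullary using (yes; no)

allF : {m : ℕ} → (Fin m → Bool) → Bool
allF {m} p = Data.List.foldr (λ i b → p i ∧ b) true (allFin m)

countF : {m : ℕ} → (Fin m → Bool) → ℕ
countF {m} p = length (Data.List.filter (λ i → Data.Bool.T? (p i)) (allFin m))

eqF : {m : ℕ} → Fin m → Fin m → Bool
eqF i j = ⌊ i ≟ j ⌋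

allVecs : (m n : ℕ) → List (Vec (Fin n) m)
allVecs zero n = [] ∷ []
allVecs (suc m) n = concatMap (λ v → map (λ x → x ∷ v) (allFin n)) (allVecs m n)

-- σ (a map Fin m → Fin m given as a vector) is a permutation (injective, hence bijective).
isPerm : {m : ℕ} → Vec (Fin m) m → Bool
isPerm σ = allF (λ i → allF (λ j → not (eqF (lookup σ i) (lookup σ j)) Data.Bool.∨ eqF i j))

iter : {m : ℕ} → Vec (Fin m) m → ℕ → Fin m → Fin m
iter σ zero i = i
iter σ (suc j) i = lookup σ (iter σ j i)

-- i is the least element of its cycle under σ (orbit = {σ^j i : j < m}).
-- Cycles of σ correspond bijectively to such cycle-minima.
isCycleMin : {m : ℕ} → Vec (Fin m) m → Fin m → Bool
isCycleMin {m} σ i = Data.List.foldr (λ j b → (toℕ i ≤ᵇ toℕ (iter σ j i)) ∧ b) true (upTo m)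

-- A colouring of the cycles of σ with colours Fin k is a colouring
-- c : [m] → Fin k of the elements that is constant on cycles: c (σ i) = c i.
-- Colour 'Fin.zero' is the special colour 1.
isCycleColouring : {m k : ℕ} → Vec (Fin m) m → Vec (Fin k) m → Bool
isCycleColouring σ c = allF (λ i → eqF (lookup c (lookup σ i)) (lookup c i))

cyclesOfColour : {m k : ℕ} → Vec (Fin m) m → Vec (Fin k) m → Fin k → ℕ
cyclesOfColour σ c a = countF (λ i → isCycleMin σ i ∧ eqF (lookup c i) a)

required : {k : ℕ} → ℕ → Fin k → ℕ
required t Fin.zero = t
required t (Fin.suc _) = 1

isMixed : {m k : ℕ} → ℕ → Vec (Fin m) m × Vec (Fin k) m → Bool
isMixed {m} {k} t (σ , c) =
  isPerm σ ∧ isCycleColouring σ c ∧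
  allF {k} (λ a → cyclesOfColour σ c a ≡ᵇ required t a)

mixedStirling : (m k t : ℕ) → ℕ
mixedStirling m k t =
  length (filter (λ p → Data.Bool.T? (isMixed t p)) (cartesianProduct (allVecs m m) (allVecs m k)))

module Submission where

open import Defs
open import Data.Nat using (ℕ; suc; _*_; _∸_; _≤_; _!)
open import Data.Nat.ListAction using (sum)
open import Data.Nat.Combinatorics using (_C_)
open import Data.List using (map; upTo)
open import Relation.Binary.PropositionalEquality using (_≡_)

-- Write [m, k/t] for mixedStirling m k t and c(n, r) for the unsigned Stirling
-- numbers of the first kind.  The proof goes through the closed form
--     t! · [m, (k+1)/t] = (t + k)! · c(m, t + k),
-- after which the theorem (with k, t ≥ 1) is the convolution identity
--     (r + 1) · c(n, r + 1) = Σ_{i<n} C(n, i+1) · i! · c(n - i - 1, r)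
-- multiplied by r! (Sums, Stirling, FromClosedForm).
--
-- The closed form is proved for the generalised count mixedCount m k r, in
-- which colour a must appear on exactly r a cycles.  Removing the largest
-- point of a permutation of [m + 1] gives a bijection (Decomposition) which
-- yields the recurrence
--     N(m+1, r) = m · N(m, r) + Σ_{a, r a > 0} N(m, r - eₐ),
-- and every solution of it satisfies  (∏ₐ r a!) · N(m, r) = s! · c(m, s)
-- with s = Σₐ r a (ClosedForm).

module Sums where

  open import Data.Nat
  open import Data.Nat.Properties
  open import Data.Fin using (Fin; zero; suc; inject₁; fromℕ)
  open import Data.List using (map; upTo; applyUpTo)
  open import Data.Nat.ListAction using (sum)
  open import Algebra.Properties.CommutativeSemigroup +-commutativeSemigroup using (interchange)
  open import Relation.Binary.PropositionalEquality
  open import Function using (_∘_)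

  sumBelow : ℕ → (ℕ → ℕ) → ℕ
  sumBelow zero    f = 0
  sumBelow (suc n) f = f 0 + sumBelow n (f ∘ suc)

  sum-upTo : ∀ n f → sum (map f (upTo n)) ≡ sumBelow n f
  sum-upTo n f = go n (λ i → i)
    where
    go : ∀ n g → sum (map f (applyUpTo g n)) ≡ sumBelow n (f ∘ g)
    go zero    g = refl
    go (suc n) g = cong (f (g 0) +_) (go n (g ∘ suc))

  sumBelow-cong : ∀ n {f g} → (∀ i → i < n → f i ≡ g i) → sumBelow n f ≡ sumBelow n g
  sumBelow-cong zero    f≗g = refl
  sumBelow-cong (suc n) f≗g =
    cong₂ _+_ (f≗g 0 z<s) (sumBelow-cong n (λ i i<n → f≗g (suc i) (s<s i<n)))

  sumBelow-+ : ∀ n f g → sumBelow n (λ i → f i + g i) ≡ sumBelow n f + sumBelow n g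
  sumBelow-+ zero    f g = refl
  sumBelow-+ (suc n) f g =
    trans (cong (f 0 + g 0 +_) (sumBelow-+ n (f ∘ suc) (g ∘ suc))) (interchange (f 0) (g 0) _ _)

  *-sumBelow : ∀ n c f → c * sumBelow n f ≡ sumBelow n (λ i → c * f i)
  *-sumBelow zero    c f = *-zeroʳ c
  *-sumBelow (suc n) c f =
    trans (*-distribˡ-+ c (f 0) _) (cong (c * f 0 +_) (*-sumBelow n c (f ∘ suc)))

  sumBelow-last : ∀ n f → sumBelow (suc n) f ≡ sumBelow n f + f n
  sumBelow-last zero    f = +-comm (f 0) 0
  sumBelow-last (suc n) f =
    trans (cong (f 0 +_) (sumBelow-last n (f ∘ suc))) (sym (+-assoc (f 0) _ _))

  sumBelow-zero : ∀ n → sumBelow n (λ _ → 0) ≡ 0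
  sumBelow-zero zero    = refl
  sumBelow-zero (suc n) = sumBelow-zero n

  sumFin : (k : ℕ) → (Fin k → ℕ) → ℕ
  sumFin zero    f = 0
  sumFin (suc k) f = f zero + sumFin k (f ∘ suc)

  prodFin : (k : ℕ) → (Fin k → ℕ) → ℕ
  prodFin zero    f = 1
  prodFin (suc k) f = f zero * prodFin k (f ∘ suc)

  sumFin-last : ∀ k (f : Fin (suc k) → ℕ) → sumFin (suc k) f ≡ sumFin k (f ∘ inject₁) + f (fromℕ k)
  sumFin-last zero    f = +-identityʳ (f zero)
  sumFin-last (suc k) f =
    trans (cong (f zero +_) (sumFin-last k (f ∘ suc))) (sym (+-assoc (f zero) _ _))

  sumFin-cong : ∀ k {f g : Fin k → ℕ} → (∀ a → f a ≡ g a) → sumFin k f ≡ sumFin k g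
  sumFin-cong zero    f≗g = refl
  sumFin-cong (suc k) f≗g = cong₂ _+_ (f≗g zero) (sumFin-cong k (f≗g ∘ suc))

  *-sumFin : ∀ k c (f : Fin k → ℕ) → c * sumFin k f ≡ sumFin k (λ a → c * f a)
  *-sumFin zero    c f = *-zeroʳ c
  *-sumFin (suc k) c f =
    trans (*-distribˡ-+ c (f zero) _) (cong (c * f zero +_) (*-sumFin k c (f ∘ suc)))

  sumFin-*ʳ : ∀ k (f : Fin k → ℕ) c → sumFin k (λ a → f a * c) ≡ sumFin k f * c
  sumFin-*ʳ zero    f c = refl
  sumFin-*ʳ (suc k) f c =
    trans (cong (f zero * c +_) (sumFin-*ʳ k (f ∘ suc) c)) (sym (*-distribʳ-+ c (f zero) _))


module Stirling where

  open import Data.Nat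
  open import Data.Nat.Properties
  open import Data.Nat.Combinatorics using (_C_; nCk+nC[k+1]≡[n+1]C[k+1]; k>n⇒nCk≡0)
  open import Data.Nat.Tactic.RingSolver using (solve-∀)
  open import Relation.Binary.PropositionalEquality
  open Sums

  -- stirling n r = number of permutations of [n] with r cycles;
  -- stirling⁻ n r = stirling n (r - 1), read as 0 for r = 0.
  stirling stirling⁻ : ℕ → ℕ → ℕ
  stirling zero    zero    = 1
  stirling zero    (suc r) = 0
  stirling (suc n) r       = n * stirling n r + stirling⁻ n r
  stirling⁻ n zero    = 0
  stirling⁻ n (suc r) = stirling n r

  convolution convolution⁻ : ℕ → ℕ → ℕ
  convolution n r = sumBelow n (λ i → (n C suc i) * i ! * stirling (n ∸ suc i) r)
  convolution⁻ n zero    = 0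
  convolution⁻ n (suc r) = convolution n r

  stirling-∸ : ∀ n i r → i < n →
    stirling (n ∸ i) r ≡ (n ∸ suc i) * stirling (n ∸ suc i) r + stirling⁻ (n ∸ suc i) r
  stirling-∸ n i r i<n = cong (λ m → stirling m r) (+-∸-assoc 1 i<n)

  convolution⁻-as-sum : ∀ n r →
    sumBelow n (λ j → (n C suc j) * j ! * stirling⁻ (n ∸ suc j) r) ≡ convolution⁻ n r
  convolution⁻-as-sum n zero    =
    trans (sumBelow-cong n (λ j _ → *-zeroʳ ((n C suc j) * j !))) (sumBelow-zero n)
  convolution⁻-as-sum n (suc r) = refl

  -- The recurrence satisfied by the convolution, from Pascal's rule
  -- C(n+1, i+1) = C(n, i) + C(n, i+1) and the recurrence of stirling.
  module ConvolutionStep (n r : ℕ) where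

    open ≡-Reasoning

    -- Pascal's rule splits convolution (suc n) r into these two sums.
    left right : ℕ → ℕ
    left  i = (n C i) * i ! * stirling (n ∸ i) r
    right i = (n C suc i) * i ! * stirling (n ∸ i) r

    pascal : convolution (suc n) r ≡ sumBelow (suc n) left + sumBelow (suc n) right
    pascal = trans (sumBelow-cong (suc n) split) (sumBelow-+ (suc n) left right)
      where
      split : ∀ i → i < suc n → (suc n C suc i) * i ! * stirling (n ∸ i) r ≡ left i + right i
      split i _ = begin
        (suc n C suc i) * i ! * stirling (n ∸ i) r
          ≡⟨ cong (λ c → c * i ! * stirling (n ∸ i) r) (sym (nCk+nC[k+1]≡[n+1]C[k+1] n i)) ⟩
        ((n C i) + (n C suc i)) * i ! * stirling (n ∸ i) r
          ≡⟨ distrib (n C i) (n C suc i) (i !) (stirling (n ∸ i) r) ⟩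
        left i + right i ∎
        where
        distrib : ∀ a b c d → (a + b) * c * d ≡ a * c * d + b * c * d
        distrib = solve-∀

    -- In the left sum, i = 0 gives stirling n r; the others are shifted.
    shifted : ℕ → ℕ
    shifted j = (n C suc j) * suc j ! * stirling (n ∸ suc j) r

    left-sum : sumBelow (suc n) left ≡ stirling n r + sumBelow n shifted
    left-sum = cong (_+ sumBelow n shifted) (+-identityʳ (stirling n r))

    -- In the right sum, i = n vanishes and the recurrence of stirling
    -- splits every other term in two.
    lowered raised : ℕ → ℕ
    lowered j = (n C suc j) * j ! * ((n ∸ suc j) * stirling (n ∸ suc j) r)
    raised  j = (n C suc j) * j ! * stirling⁻ (n ∸ suc j) r

    right-sum : sumBelow (suc n) right ≡ sumBelow n lowered + sumBelow n raised
    right-sum = begin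
      sumBelow (suc n) right
        ≡⟨ sumBelow-last n right ⟩
      sumBelow n right + (n C suc n) * n ! * stirling (n ∸ n) r
        ≡⟨ cong (λ c → sumBelow n right + c * n ! * stirling (n ∸ n) r) (k>n⇒nCk≡0 (n<1+n n)) ⟩
      sumBelow n right + 0
        ≡⟨ +-identityʳ _ ⟩
      sumBelow n right
        ≡⟨ sumBelow-cong n (λ j j<n →
             trans (cong ((n C suc j) * j ! *_) (stirling-∸ n j r j<n))
                   (*-distribˡ-+ ((n C suc j) * j !) _ _)) ⟩
      sumBelow n (λ j → lowered j + raised j)
        ≡⟨ sumBelow-+ n lowered raised ⟩
      sumBelow n lowered + sumBelow n raised ∎

    -- Term by term, shifted j + lowered j = (j + 1 + (n - j - 1)) · (term j).
    shifted+lowered : sumBelow n shifted + sumBelow n lowered ≡ n * convolution n r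
    shifted+lowered = begin
      sumBelow n shifted + sumBelow n lowered
        ≡⟨ sym (sumBelow-+ n shifted lowered) ⟩
      sumBelow n (λ j → shifted j + lowered j)
        ≡⟨ sumBelow-cong n (λ j j<n →
             trans (collect (n C suc j) (j !) j (n ∸ suc j) (stirling (n ∸ suc j) r))
                   (cong (_* ((n C suc j) * j ! * stirling (n ∸ suc j) r)) (m+[n∸m]≡n j<n))) ⟩
      sumBelow n (λ j → n * ((n C suc j) * j ! * stirling (n ∸ suc j) r))
        ≡⟨ sym (*-sumBelow n n _) ⟩
      n * convolution n r ∎
      where
      collect : ∀ c f j m s → c * (suc j * f) * s + c * f * (m * s) ≡ (suc j + m) * (c * f * s)
      collect = solve-∀

    convolution-suc : convolution (suc n) r ≡ stirling n r + n * convolution n r + convolution⁻ n r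
    convolution-suc = begin
      convolution (suc n) r
        ≡⟨ pascal ⟩
      sumBelow (suc n) left + sumBelow (suc n) right
        ≡⟨ cong₂ _+_ left-sum right-sum ⟩
      stirling n r + sumBelow n shifted + (sumBelow n lowered + sumBelow n raised)
        ≡⟨ regroup (stirling n r) (sumBelow n shifted) _ _ ⟩
      stirling n r + (sumBelow n shifted + sumBelow n lowered) + sumBelow n raised
        ≡⟨ cong₂ (λ a b → stirling n r + a + b) shifted+lowered (convolution⁻-as-sum n r) ⟩
      stirling n r + n * convolution n r + convolution⁻ n r ∎
      where
      regroup : ∀ a b c d → a + b + (c + d) ≡ a + (b + c) + d
      regroup = solve-∀

  stirling-convolution : ∀ n r → suc r * stirling n (suc r) ≡ convolution n r
  stirling-convolution zero    r = *-zeroʳ r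
  stirling-convolution (suc n) r = begin
    suc r * (n * stirling n (suc r) + stirling n r)
      ≡⟨ expand r n (stirling n (suc r)) (stirling n r) ⟩
    stirling n r + n * (suc r * stirling n (suc r)) + r * stirling n r
      ≡⟨ cong₂ (λ a b → stirling n r + n * a + b) (stirling-convolution n r) (shift r) ⟩
    stirling n r + n * convolution n r + convolution⁻ n r
      ≡⟨ sym (ConvolutionStep.convolution-suc n r) ⟩
    convolution (suc n) r ∎
    where
    open ≡-Reasoning
    expand : ∀ r n a b → suc r * (n * a + b) ≡ b + n * (suc r * a) + r * b
    expand = solve-∀
    shift : ∀ r → r * stirling n r ≡ convolution⁻ n r
    shift zero    = refl
    shift (suc r) = stirling-convolution n r

  -- The recurrence of stirling, weighted by factorials: the arithmetic core
  -- of the closed form for mixed coloured permutations.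
  stirling-suc-factorial : ∀ m s →
    m * (s ! * stirling m s) + s * (pred s ! * stirling m (pred s)) ≡ s ! * stirling (suc m) s
  stirling-suc-factorial m zero    = identity m (stirling m 0) (stirling m 0)
    where
    identity : ∀ m a x → m * (1 * a) + 0 * x ≡ 1 * (m * a + 0)
    identity = solve-∀
  stirling-suc-factorial m (suc s) = identity m s (s !) (stirling m (suc s)) (stirling m s)
    where
    identity : ∀ m s f a b → m * (suc s * f * a) + suc s * (f * b) ≡ suc s * f * (m * a + b)
    identity = solve-∀


-- Requirement vectors r : Fin k → ℕ prescribe how many cycles of each
-- colour a permutation must have.  Removing a fixed point of colour a
-- lowers r a by one.
module Requirements where

  open import Data.Nat
  open import Data.Nat.Properties
  open import Data.Fin using (Fin; zero; suc)
  open import Data.Product using (Σ; _,_)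
  open import Data.Empty using (⊥-elim)
  open import Algebra.Properties.CommutativeSemigroup *-commutativeSemigroup using (x∙yz≈y∙xz)
  open import Relation.Binary.PropositionalEquality
  open import Function using (_∘_)
  open Sums

  decrease : ∀ {k} → Fin k → (Fin k → ℕ) → Fin k → ℕ
  decrease zero    r zero    = pred (r zero)
  decrease zero    r (suc b) = r (suc b)
  decrease (suc a) r zero    = r zero
  decrease (suc a) r (suc b) = decrease a (r ∘ suc) b

  decrease-self : ∀ {k} (a : Fin k) r → decrease a r a ≡ pred (r a)
  decrease-self zero    r = refl
  decrease-self (suc a) r = decrease-self a (r ∘ suc)

  decrease-other : ∀ {k} (a b : Fin k) r → a ≢ b → decrease a r b ≡ r b
  decrease-other zero    zero    r a≢b = ⊥-elim (a≢b refl)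
  decrease-other zero    (suc b) r a≢b = refl
  decrease-other (suc a) zero    r a≢b = refl
  decrease-other (suc a) (suc b) r a≢b = decrease-other a b (r ∘ suc) (a≢b ∘ cong suc)

  sumFin-decrease : ∀ k (a : Fin k) r {u} → r a ≡ suc u → sumFin k r ≡ suc (sumFin k (decrease a r))
  sumFin-decrease (suc k) zero    r ra≡1+u rewrite ra≡1+u = refl
  sumFin-decrease (suc k) (suc a) r ra≡1+u =
    trans (cong (r zero +_) (sumFin-decrease k a (r ∘ suc) ra≡1+u)) (+-suc (r zero) _)

  prodFin-decrease : ∀ k (a : Fin k) r {u} → r a ≡ suc u →
    prodFin k (λ b → r b !) ≡ suc u * prodFin k (λ b → decrease a r b !)
  prodFin-decrease (suc k) zero    r {u} ra≡1+u rewrite ra≡1+u = *-assoc (suc u) (u !) _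
  prodFin-decrease (suc k) (suc a) r {u} ra≡1+u =
    trans (cong (r zero ! *_) (prodFin-decrease k a (r ∘ suc) ra≡1+u))
          (x∙yz≈y∙xz (r zero !) (suc u) _)

  -- A requirement vector with total 0 is identically 0.
  sumFin≡0⇒prodFin≡1 : ∀ k (r : Fin k → ℕ) → sumFin k r ≡ 0 → prodFin k (λ b → r b !) ≡ 1
  sumFin≡0⇒prodFin≡1 zero    r _ = refl
  sumFin≡0⇒prodFin≡1 (suc k) r Σr≡0 with r zero
  ... | zero = trans (+-identityʳ _) (sumFin≡0⇒prodFin≡1 k (r ∘ suc) Σr≡0)

  Positive : ℕ → Set
  Positive n = Σ ℕ (λ u → n ≡ suc u)

  Positive-irrelevant : ∀ {n} (p q : Positive n) → p ≡ q
  Positive-irrelevant (u , n≡1+u) (v , n≡1+v) with suc-injective (trans (sym n≡1+u) n≡1+v)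
  ... | refl = cong (u ,_) (≡-irrelevant n≡1+u n≡1+v)

  whenPositive : ℕ → ℕ → ℕ
  whenPositive zero    x = 0
  whenPositive (suc _) x = x

  isZero : ℕ → ℕ
  isZero zero    = 1
  isZero (suc _) = 0


-- Any count N m r satisfying the recurrence obtained by removing the point
-- m of [m + 1] — either it lies on a longer cycle (m choices of predecessor)
-- or it is a fixed point of some colour a — is given by
--   (∏ₐ r a !) · N m r = s! · stirling m s,   where s = Σₐ r a.
module ClosedForm where

  open import Data.Nat
  open import Data.Nat.Properties
  open import Data.Fin using (Fin)
  open import Relation.Binary.PropositionalEquality
  open import Algebra.Properties.CommutativeSemigroup *-commutativeSemigroup using (x∙yz≈y∙xz)
  open Sums
  open Stirling
  open Requirements

  module _
    (N : (m k : ℕ) → (Fin k → ℕ) → ℕ)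
    (N-zero : ∀ k r → N 0 k r ≡ isZero (sumFin k r))
    (N-suc : ∀ m k r → N (suc m) k r ≡
       m * N m k r + sumFin k (λ a → whenPositive (r a) (N m k (decrease a r))))
    where

    closed-form : ∀ m k r → prodFin k (λ a → r a !) * N m k r ≡ sumFin k r ! * stirling m (sumFin k r)
    closed-form zero k r rewrite N-zero k r with sumFin k r in Σr≡s
    ... | zero  = trans (*-identityʳ _) (sumFin≡0⇒prodFin≡1 k r Σr≡s)
    ... | suc s = trans (*-zeroʳ (prodFin k (λ a → r a !))) (sym (*-zeroʳ (suc s !)))
    closed-form (suc m) k r = begin
      P * N (suc m) k r
        ≡⟨ cong (P *_) (N-suc m k r) ⟩
      P * (m * N m k r + sumFin k (λ a → whenPositive (r a) (N m k (decrease a r))))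
        ≡⟨ trans (*-distribˡ-+ P _ _) (cong₂ _+_ (x∙yz≈y∙xz P m _) (*-sumFin k P _)) ⟩
      m * (P * N m k r) + sumFin k (λ a → P * whenPositive (r a) (N m k (decrease a r)))
        ≡⟨ cong₂ _+_ (cong (m *_) (closed-form m k r)) (sumFin-cong k removed-fixed-point) ⟩
      m * (s ! * stirling m s) + sumFin k (λ a → r a * X)
        ≡⟨ cong (m * (s ! * stirling m s) +_) (sumFin-*ʳ k r X) ⟩
      m * (s ! * stirling m s) + s * X
        ≡⟨ stirling-suc-factorial m s ⟩
      s ! * stirling (suc m) s ∎
      where
      open ≡-Reasoning
      P = prodFin k (λ a → r a !)
      s = sumFin k r
      X = pred s ! * stirling m (pred s)
      removed-fixed-point : ∀ a → P * whenPositive (r a) (N m k (decrease a r)) ≡ r a * X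
      removed-fixed-point a with r a in ra≡
      ... | zero  = *-zeroʳ P
      ... | suc u = begin
        P * N m k (decrease a r)
          ≡⟨ cong (_* N m k (decrease a r)) (prodFin-decrease k a r ra≡) ⟩
        suc u * prodFin k (λ b → decrease a r b !) * N m k (decrease a r)
          ≡⟨ *-assoc (suc u) (prodFin k (λ b → decrease a r b !)) _ ⟩
        suc u * (prodFin k (λ b → decrease a r b !) * N m k (decrease a r))
          ≡⟨ cong (suc u *_) (closed-form m k (decrease a r)) ⟩
        suc u * (sumFin k (decrease a r) ! * stirling m (sumFin k (decrease a r)))
          ≡⟨ cong (λ s → suc u * (pred s ! * stirling m (pred s))) (sym (sumFin-decrease k a r ra≡)) ⟩
        suc u * X ∎


-- Any M with the closed form  t! · M m (k + 1) t = (t + k)! · stirling m (t + k)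
-- satisfies the identity of the theorem: after multiplying by t! both sides
-- become (t + k)! times the two sides of stirling-convolution.
module FromClosedForm where

  open import Data.Nat
  open import Data.Nat.Properties
  open import Data.Nat.Tactic.RingSolver using (solve-∀)
  open import Relation.Binary.PropositionalEquality
  open import Algebra.Properties.CommutativeSemigroup *-commutativeSemigroup using (x∙yz≈y∙xz)
  open Sums
  open Stirling

  module _
    (M : ℕ → ℕ → ℕ → ℕ)
    (closed : ∀ m k t → t ! * M m (suc k) t ≡ (t + k) ! * stirling m (t + k))
    where

    convolution-identity : ∀ n k t →
      suc t * M n (suc k) (suc t) ≡ sum (map (λ i → (n C suc i) * (i !) * M (n ∸ suc i) (suc k) t) (upTo n))
    convolution-identity n k t = *-cancelˡ-≡ _ _ (t !) {{t !≢0}} (trans lhs (sym rhs))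
      where
      open ≡-Reasoning
      R = t + k
      term : ℕ → ℕ
      term i = (n C suc i) * (i !) * M (n ∸ suc i) (suc k) t
      lhs : t ! * (suc t * M n (suc k) (suc t)) ≡ R ! * convolution n R
      lhs = begin
        t ! * (suc t * M n (suc k) (suc t))  ≡⟨ reassoc (t !) (suc t) _ ⟩
        suc t ! * M n (suc k) (suc t)        ≡⟨ closed n k (suc t) ⟩
        suc R ! * stirling n (suc R)         ≡⟨ *-assoc (suc R) (R !) _ ⟩
        suc R * (R ! * stirling n (suc R))   ≡⟨ x∙yz≈y∙xz (suc R) (R !) _ ⟩
        R ! * (suc R * stirling n (suc R))   ≡⟨ cong (R ! *_) (stirling-convolution n R) ⟩
        R ! * convolution n R                ∎
        where
        reassoc : ∀ a b c → a * (b * c) ≡ b * a * c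
        reassoc = solve-∀
      rhs : t ! * sum (map term (upTo n)) ≡ R ! * convolution n R
      rhs = begin
        t ! * sum (map term (upTo n))
          ≡⟨ cong (t ! *_) (sum-upTo n term) ⟩
        t ! * sumBelow n term
          ≡⟨ *-sumBelow n (t !) term ⟩
        sumBelow n (λ i → t ! * term i)
          ≡⟨ sumBelow-cong n (λ i _ → trans (x∙yz≈y∙xz (t !) ((n C suc i) * i !) _)
               (trans (cong ((n C suc i) * i ! *_) (closed (n ∸ suc i) k t))
                      (x∙yz≈y∙xz ((n C suc i) * i !) (R !) _))) ⟩
        sumBelow n (λ i → R ! * ((n C suc i) * i ! * stirling (n ∸ suc i) R))
          ≡⟨ sym (*-sumBelow n (R !) _) ⟩
        R ! * convolution n R ∎


-- Counting by bijection: the length of a filtered enumeration is the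
-- cardinality of the corresponding Σ-type.
module Counting where

  open import Data.Nat using (ℕ; zero; suc; _+_)
  open import Data.Nat.Properties using (+-assoc; +-identityʳ)
  open import Data.Bool using (Bool; true; false; T; T?)
  open import Data.Fin using (Fin; zero; suc)
  open import Data.Fin.Properties using (0↔⊥; +↔⊎)
  open import Data.Vec using (Vec; []; _∷_)
  open import Data.List using (List; []; _∷_; map; concatMap; filter; length; allFin; tabulate; cartesianProduct; _++_)
  open import Data.Product using (Σ; _×_; _,_)
  open import Data.Product.Function.Dependent.Propositional using (Σ-↔)
  open import Data.Product.Algebra using (Σ-assoc)
  open import Data.Sum using (_⊎_; inj₁; inj₂)
  open import Data.Sum.Function.Propositional using (_⊎-↔_)
  open import Data.Empty using (⊥)
  open import Data.Unit using (tt)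
  open import Function using (_∘_; _↔_; mk↔ₛ′)
  open import Function.Properties.Inverse using (↔-refl; ↔-sym; ↔-trans)
  open import Relation.Binary.PropositionalEquality
  open Sums using (sumFin)

  indicator : Bool → ℕ
  indicator true  = 1
  indicator false = 0

  weight : ∀ {A : Set} → (A → ℕ) → List A → ℕ
  weight f []       = 0
  weight f (x ∷ xs) = f x + weight f xs

  length-filter : ∀ {A : Set} (P : A → Bool) xs →
    length (filter (T? ∘ P) xs) ≡ weight (indicator ∘ P) xs
  length-filter P []       = refl
  length-filter P (x ∷ xs) with P x
  ... | true  = cong suc (length-filter P xs)
  ... | false = length-filter P xs

  weight-cong : ∀ {A : Set} {f g : A → ℕ} → (∀ x → f x ≡ g x) → ∀ xs → weight f xs ≡ weight g xs
  weight-cong f≗g []       = refl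
  weight-cong f≗g (x ∷ xs) = cong₂ _+_ (f≗g x) (weight-cong f≗g xs)

  weight-++ : ∀ {A : Set} (f : A → ℕ) xs ys → weight f (xs ++ ys) ≡ weight f xs + weight f ys
  weight-++ f []       ys = refl
  weight-++ f (x ∷ xs) ys = trans (cong (f x +_) (weight-++ f xs ys)) (sym (+-assoc (f x) _ _))

  weight-map : ∀ {A B : Set} (f : B → ℕ) (g : A → B) xs → weight f (map g xs) ≡ weight (f ∘ g) xs
  weight-map f g []       = refl
  weight-map f g (x ∷ xs) = cong (f (g x) +_) (weight-map f g xs)

  weight-concatMap : ∀ {A B : Set} (f : B → ℕ) (g : A → List B) xs →
    weight f (concatMap g xs) ≡ weight (weight f ∘ g) xs
  weight-concatMap f g []       = refl
  weight-concatMap f g (x ∷ xs) =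
    trans (weight-++ f (g x) (concatMap g xs)) (cong (weight f (g x) +_) (weight-concatMap f g xs))

  weight-cartesianProduct : ∀ {A B : Set} (f : A × B → ℕ) xs ys →
    weight f (cartesianProduct xs ys) ≡ weight (λ x → weight (λ y → f (x , y)) ys) xs
  weight-cartesianProduct f []       ys = refl
  weight-cartesianProduct f (x ∷ xs) ys =
    trans (weight-++ f (map (x ,_) ys) (cartesianProduct xs ys))
          (cong₂ _+_ (weight-map f (x ,_) ys) (weight-cartesianProduct f xs ys))

  weight-tabulate : ∀ {A : Set} n (f : A → ℕ) (h : Fin n → A) → weight f (tabulate h) ≡ sumFin n (f ∘ h)
  weight-tabulate zero    f h = refl
  weight-tabulate (suc n) f h = cong (f (h zero) +_) (weight-tabulate n f (h ∘ suc))

  ≡⇒Fin↔ : ∀ {a b} → a ≡ b → Fin a ↔ Fin b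
  ≡⇒Fin↔ refl = ↔-refl

  Σ-Fin-suc : ∀ {n} (B : Fin (suc n) → Set) → Σ (Fin (suc n)) B ↔ (B zero ⊎ Σ (Fin n) (B ∘ suc))
  Σ-Fin-suc B = mk↔ₛ′
    (λ { (zero , b) → inj₁ b ; (suc i , b) → inj₂ (i , b) })
    (λ { (inj₁ b) → zero , b ; (inj₂ (i , b)) → suc i , b })
    (λ { (inj₁ b) → refl ; (inj₂ _) → refl })
    (λ { (zero , b) → refl ; (suc i , b) → refl })

  Σ-Fin-zero : (B : Fin 0 → Set) → Σ (Fin 0) B ↔ ⊥
  Σ-Fin-zero B = mk↔ₛ′ (λ { (() , _) }) (λ ()) (λ ()) (λ { (() , _) })

  Fin-sumFin : ∀ k (f : Fin k → ℕ) → Fin (sumFin k f) ↔ Σ (Fin k) (Fin ∘ f)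
  Fin-sumFin zero    f = ↔-trans 0↔⊥ (↔-sym (Σ-Fin-zero _))
  Fin-sumFin (suc k) f =
    ↔-trans +↔⊎ (↔-trans (↔-refl ⊎-↔ Fin-sumFin k (f ∘ suc)) (↔-sym (Σ-Fin-suc _)))

  Fin-indicator : ∀ b → Fin (indicator b) ↔ T b
  Fin-indicator true  = mk↔ₛ′ (λ _ → tt) (λ _ → zero) (λ _ → refl) (λ { zero → refl })
  Fin-indicator false = mk↔ₛ′ (λ ()) (λ ()) (λ ()) (λ ())

  Fin-weight-allVecs : ∀ m n (f : Vec (Fin n) m → ℕ) →
    Fin (weight f (allVecs m n)) ↔ Σ (Vec (Fin n) m) (Fin ∘ f)
  Fin-weight-allVecs zero    n f = ↔-trans (≡⇒Fin↔ (+-identityʳ (f []))) (↔-sym Σ-Vec-zero)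
    where
    Σ-Vec-zero : Σ (Vec (Fin n) 0) (Fin ∘ f) ↔ Fin (f [])
    Σ-Vec-zero = mk↔ₛ′ (λ { ([] , b) → b }) ([] ,_) (λ _ → refl) (λ { ([] , b) → refl })
  Fin-weight-allVecs (suc m) n f =
    ↔-trans (≡⇒Fin↔ weight-extend)
    (↔-trans (Fin-weight-allVecs m n _)
    (↔-trans (Σ-↔ ↔-refl (Fin-sumFin n _)) Σ-Vec-suc))
    where
    weight-extend : weight f (allVecs (suc m) n) ≡ weight (λ v → sumFin n (λ x → f (x ∷ v))) (allVecs m n)
    weight-extend = trans (weight-concatMap f _ (allVecs m n))
      (weight-cong (λ v → trans (weight-map f (_∷ v) (allFin n)) (weight-tabulate n (f ∘ (_∷ v)) (λ x → x)))
                   (allVecs m n))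
    Σ-Vec-suc : Σ (Vec (Fin n) m) (λ v → Σ (Fin n) (λ x → Fin (f (x ∷ v))))
              ↔ Σ (Vec (Fin n) (suc m)) (Fin ∘ f)
    Σ-Vec-suc = mk↔ₛ′ (λ { (v , x , b) → x ∷ v , b }) (λ { (x ∷ v , b) → v , x , b })
      (λ { (x ∷ v , b) → refl }) (λ { (v , x , b) → refl })

  Fin-count : ∀ {m n m′ n′} (P : Vec (Fin n) m × Vec (Fin n′) m′ → Bool) →
    Fin (length (filter (T? ∘ P) (cartesianProduct (allVecs m n) (allVecs m′ n′))))
      ↔ Σ (Vec (Fin n) m × Vec (Fin n′) m′) (T ∘ P)
  Fin-count {m} {n} {m′} {n′} P =
    ↔-trans (≡⇒Fin↔ (trans (length-filter P (cartesianProduct (allVecs m n) (allVecs m′ n′)))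
                            (weight-cartesianProduct _ (allVecs m n) (allVecs m′ n′))))
    (↔-trans (Fin-weight-allVecs m n _)
    (↔-trans (Σ-↔ ↔-refl (Fin-weight-allVecs m′ n′ _))
    (↔-trans (↔-sym Σ-assoc)
    (Σ-↔ ↔-refl (Fin-indicator (P _))))))


module Permutations where

  open import Data.Nat
  open import Data.Nat.Properties
  open import Data.Nat.DivMod using (_%_; _/_; m≡m%n+[m/n]*n; m%n<n)
  open import Data.Fin using (Fin; toℕ)
  open import Data.Fin.Properties using (pigeonhole; toℕ<n)
  open import Data.Vec using (Vec; lookup)
  open import Data.Product using (Σ; _×_; _,_)
  open import Relation.Binary.PropositionalEquality

  -- Injective, hence bijective on the finite set Fin n.
  IsPermutation : ∀ {n} → Vec (Fin n) n → Set
  IsPermutation σ = ∀ i j → lookup σ i ≡ lookup σ j → i ≡ j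

  iter-+ : ∀ {n} (σ : Vec (Fin n) n) a b i → iter σ (a + b) i ≡ iter σ a (iter σ b i)
  iter-+ σ zero    b i = refl
  iter-+ σ (suc a) b i = cong (lookup σ) (iter-+ σ a b i)

  iter-injective : ∀ {n} (σ : Vec (Fin n) n) → IsPermutation σ →
    ∀ a u v → iter σ a u ≡ iter σ a v → u ≡ v
  iter-injective σ σ-perm zero    u v eq = eq
  iter-injective σ σ-perm (suc a) u v eq = iter-injective σ σ-perm a u v (σ-perm _ _ eq)

  -- Every point returns to itself after some p ∈ [1, n] steps: by the
  -- pigeonhole principle σᵃ i = σᵇ i for some a < b ≤ n, and σ is injective.
  period : ∀ {n} (σ : Vec (Fin n) n) → IsPermutation σ → (i : Fin n) →
    Σ ℕ (λ p → 0 < p × p ≤ n × iter σ p i ≡ i)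
  period {n} σ σ-perm i with pigeonhole (n<1+n n) (λ (j : Fin (suc n)) → iter σ (toℕ j) i)
  ... | a , b , a<b , σᵃi≡σᵇi = toℕ b ∸ toℕ a , m<n⇒0<n∸m a<b , p≤n , returns
    where
    p≤n : toℕ b ∸ toℕ a ≤ n
    p≤n = ≤-trans (m∸n≤m (toℕ b) (toℕ a)) (≤-pred (toℕ<n b))
    returns : iter σ (toℕ b ∸ toℕ a) i ≡ i
    returns = iter-injective σ σ-perm (toℕ a) _ i (begin
      iter σ (toℕ a) (iter σ (toℕ b ∸ toℕ a) i)  ≡⟨ iter-+ σ (toℕ a) _ i ⟨
      iter σ (toℕ a + (toℕ b ∸ toℕ a)) i         ≡⟨ cong (λ j → iter σ j i) (m+[n∸m]≡n (<⇒≤ a<b)) ⟩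
      iter σ (toℕ b) i                           ≡⟨ σᵃi≡σᵇi ⟨
      iter σ (toℕ a) i                           ∎)
      where open ≡-Reasoning

  iter-periodic : ∀ {n} (σ : Vec (Fin n) n) p i → iter σ p i ≡ i → ∀ q → iter σ (q * p) i ≡ i
  iter-periodic σ p i σᵖi≡i zero    = refl
  iter-periodic σ p i σᵖi≡i (suc q) =
    trans (iter-+ σ p (q * p) i) (trans (cong (iter σ p) (iter-periodic σ p i σᵖi≡i q)) σᵖi≡i)

  orbit-bounded : ∀ {n} (σ : Vec (Fin n) n) → IsPermutation σ → (i : Fin n) (Q : Fin n → Set) →
    (∀ j → j < n → Q (iter σ j i)) → ∀ j → Q (iter σ j i)
  orbit-bounded {n} σ σ-perm i Q Q-below j with period σ σ-perm i
  ... | suc p , _ , p<n , σᵖi≡i =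
    subst Q (sym reduce) (Q-below (j % suc p) (<-≤-trans (m%n<n j (suc p)) p<n))
    where
    reduce : iter σ j i ≡ iter σ (j % suc p) i
    reduce = trans (cong (λ j → iter σ j i) (m≡m%n+[m/n]*n j (suc p)))
      (trans (iter-+ σ (j % suc p) ((j / suc p) * suc p) i)
             (cong (iter σ (j % suc p)) (iter-periodic σ (suc p) i σᵖi≡i (j / suc p))))

  IsCycleMin : ∀ {n} → Vec (Fin n) n → Fin n → Set
  IsCycleMin σ i = ∀ j → toℕ i ≤ toℕ (iter σ j i)


module Reflection where

  open Permutations
  open import Data.Nat using (_≤_)
  open import Data.Nat.Properties using (≤ᵇ⇒≤; ≤⇒≤ᵇ)
  open import Data.Bool using (Bool; true; false; T; _∧_; _∨_; not)
  open import Data.Bool.Properties using (T-∧)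
  open import Data.Fin using (Fin; toℕ)
  open import Data.Fin.Properties using (_≟_)
  open import Data.Vec using (Vec; lookup)
  open import Data.List using (List; []; _∷_; foldr; allFin; upTo)
  open import Data.List.Relation.Unary.All as All using (All; []; _∷_)
  open import Data.List.Membership.Propositional.Properties using (∈-allFin; ∈-upTo⁺)
  open import Data.Product using (_,_)
  open import Data.Unit using (tt)
  open import Data.Empty using (⊥-elim)
  open import Function using (_∘_; id; Equivalence)
  open import Relation.Nullary using (yes; no)
  open import Relation.Nullary.Decidable using (toWitness; isYes≗does; dec-true; dec-false)
  open import Relation.Binary.PropositionalEquality
  open Equivalence using (to; from)

  conjunction⇒All : ∀ {A : Set} (p : A → Bool) xs → T (foldr (λ x b → p x ∧ b) true xs) → All (T ∘ p) xs
  conjunction⇒All p []       _ = []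
  conjunction⇒All p (x ∷ xs) h with to T-∧ h
  ... | px , pxs = px ∷ conjunction⇒All p xs pxs

  All⇒conjunction : ∀ {A : Set} (p : A → Bool) xs → All (T ∘ p) xs → T (foldr (λ x b → p x ∧ b) true xs)
  All⇒conjunction p []       []         = tt
  All⇒conjunction p (x ∷ xs) (px ∷ pxs) = from T-∧ (px , All⇒conjunction p xs pxs)

  allF⇒ : ∀ {n} (p : Fin n → Bool) → T (allF p) → ∀ a → T (p a)
  allF⇒ {n} p h a = All.lookup (conjunction⇒All p (allFin n) h) (∈-allFin a)

  ⇒allF : ∀ {n} (p : Fin n → Bool) → (∀ a → T (p a)) → T (allF p)
  ⇒allF {n} p h = All⇒conjunction p (allFin n) (All.tabulate (λ {a} _ → h a))

  eqF-refl : ∀ {n} (i : Fin n) → eqF i i ≡ true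
  eqF-refl i = trans (isYes≗does (i ≟ i)) (dec-true (i ≟ i) refl)

  eqF-≢ : ∀ {n} {i j : Fin n} → i ≢ j → eqF i j ≡ false
  eqF-≢ {i = i} {j} i≢j = trans (isYes≗does (i ≟ j)) (dec-false (i ≟ j) i≢j)

  isPerm⇒ : ∀ {n} (σ : Vec (Fin n) n) → T (isPerm σ) → IsPermutation σ
  isPerm⇒ σ h i j σi≡σj = toWitness (injective-at (allF⇒ _ (allF⇒ _ h i) j))
    where
    injective-at : T (not (eqF (lookup σ i) (lookup σ j)) ∨ eqF i j) → T (eqF i j)
    injective-at h rewrite σi≡σj | eqF-refl (lookup σ j) = h

  ⇒isPerm : ∀ {n} (σ : Vec (Fin n) n) → IsPermutation σ → T (isPerm σ)
  ⇒isPerm σ σ-perm = ⇒allF _ (λ i → ⇒allF _ (λ j → injective-at i j))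
    where
    injective-at : ∀ i j → T (not (eqF (lookup σ i) (lookup σ j)) ∨ eqF i j)
    injective-at i j with lookup σ i ≟ lookup σ j
    ... | no  _     = tt
    ... | yes σi≡σj =
      subst (λ b → T (false ∨ b)) (sym (trans (isYes≗does (i ≟ j)) (dec-true (i ≟ j) (σ-perm i j σi≡σj)))) tt

  -- isCycleMin only inspects σʲ i for j < n, which suffices by orbit-bounded.
  isCycleMin⇒ : ∀ {n} (σ : Vec (Fin n) n) → IsPermutation σ → ∀ i → T (isCycleMin σ i) → IsCycleMin σ i
  isCycleMin⇒ {n} σ σ-perm i h = orbit-bounded σ σ-perm i (λ z → toℕ i ≤ toℕ z)
    (λ j j<n → ≤ᵇ⇒≤ (toℕ i) _ (All.lookup (conjunction⇒All _ (upTo n) h) (∈-upTo⁺ j<n)))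

  ⇒isCycleMin : ∀ {n} (σ : Vec (Fin n) n) i → IsCycleMin σ i → T (isCycleMin σ i)
  ⇒isCycleMin {n} σ i i-min = All⇒conjunction _ (upTo n) (All.tabulate (λ {j} _ → ≤⇒≤ᵇ (i-min j)))

  countF≡sumFin : ∀ {n} (p : Fin n → Bool) → countF p ≡ Sums.sumFin n (Counting.indicator ∘ p)
  countF≡sumFin {n} p = trans (Counting.length-filter p (allFin n)) (Counting.weight-tabulate n _ id)

  T-ext : ∀ {a b : Bool} → (T a → T b) → (T b → T a) → a ≡ b
  T-ext {false} {false} _   _   = refl
  T-ext {false} {true}  _   b⇒a = ⊥-elim (b⇒a tt)
  T-ext {true}  {false} a⇒b _   = ⊥-elim (a⇒b tt)
  T-ext {true}  {true}  _   _   = refl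


-- Mixed coloured permutations with an arbitrary requirement vector r:
-- colour a must be used on exactly r a cycles.  By definition,
-- mixedStirling m k t is mixedCount m k (required t).
module MixedCount where

  open Permutations
  open Reflection
  open import Data.Nat using (ℕ; _≡ᵇ_)
  open import Data.Nat.Properties using (≡ᵇ⇒≡; ≡⇒≡ᵇ)
  open import Data.Bool using (Bool; T; T?; _∧_)
  open import Data.Bool.Properties using (T-∧; T-irrelevant)
  open import Data.Fin using (Fin)
  open import Data.Vec using (Vec; lookup)
  open import Data.List using (filter; length; cartesianProduct)
  open import Data.Product using (Σ; _×_; _,_)
  open import Function using (_∘_; _↔_; Equivalence)
  open import Relation.Nullary.Decidable using (toWitness; fromWitness)
  open import Relation.Binary.PropositionalEquality
  open Equivalence using (to; from)

  isMixedFor : ∀ {m k} → (Fin k → ℕ) → Vec (Fin m) m × Vec (Fin k) m → Bool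
  isMixedFor r (σ , c) =
    isPerm σ ∧ isCycleColouring σ c ∧ allF (λ a → cyclesOfColour σ c a ≡ᵇ r a)

  mixedCount : (m k : ℕ) → (Fin k → ℕ) → ℕ
  mixedCount m k r =
    length (filter (T? ∘ isMixedFor r) (cartesianProduct (allVecs m m) (allVecs m k)))

  Mixed : (m k : ℕ) → (Fin k → ℕ) → Set
  Mixed m k r = Σ (Vec (Fin m) m × Vec (Fin k) m) (T ∘ isMixedFor r)

  Mixed-≡ : ∀ {m k r} {p q : Vec (Fin m) m × Vec (Fin k) m} {h : T (isMixedFor r p)} {h′ : T (isMixedFor r q)} →
    p ≡ q → _≡_ {A = Mixed m k r} (p , h) (q , h′)
  Mixed-≡ {h = h} {h′} refl = cong (_ ,_) (T-irrelevant h h′)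

  Fin-mixedCount : ∀ m k r → Fin (mixedCount m k r) ↔ Mixed m k r
  Fin-mixedCount m k r = Counting.Fin-count (isMixedFor r)

  IsColouring : ∀ {m k} → Vec (Fin m) m → Vec (Fin k) m → Set
  IsColouring σ c = ∀ i → lookup c (lookup σ i) ≡ lookup c i

  HasCycleCounts : ∀ {m k} → (Fin k → ℕ) → Vec (Fin m) m → Vec (Fin k) m → Set
  HasCycleCounts r σ c = ∀ a → cyclesOfColour σ c a ≡ r a

  IsMixedFor : ∀ {m k} → (Fin k → ℕ) → Vec (Fin m) m × Vec (Fin k) m → Set
  IsMixedFor r (σ , c) = IsPermutation σ × IsColouring σ c × HasCycleCounts r σ c

  -- Kept opaque: only the statements matter, and unfolding the proofs makes
  -- checking the bijection of Decomposition expensive.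
  opaque
    isMixedFor⇒ : ∀ {m k} r (p : Vec (Fin m) m × Vec (Fin k) m) → T (isMixedFor r p) → IsMixedFor r p
    isMixedFor⇒ r (σ , c) h with to (T-∧ {isPerm σ}) h
    ... | perm , rest with to (T-∧ {isCycleColouring σ c}) rest
    ... | colouring , counts =
      isPerm⇒ σ perm ,
      (λ i → toWitness (allF⇒ _ colouring i)) ,
      (λ a → ≡ᵇ⇒≡ _ _ (allF⇒ _ counts a))

    ⇒isMixedFor : ∀ {m k} r (p : Vec (Fin m) m × Vec (Fin k) m) → IsMixedFor r p → T (isMixedFor r p)
    ⇒isMixedFor r (σ , c) (perm , colouring , counts) =
      from (T-∧ {isPerm σ}) (⇒isPerm σ perm ,
        from (T-∧ {isCycleColouring σ c}) (⇒allF _ (fromWitness ∘ colouring) , ⇒allF _ (λ a → ≡⇒≡ᵇ _ _ (counts a))))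


module Snoc where

  open import Data.Nat using (ℕ; zero; suc)
  open import Data.Fin using (Fin; zero; suc; inject₁; fromℕ)
  open import Data.Vec using (Vec; []; _∷_; lookup; _∷ʳ_; init)
  open import Data.Vec.Properties using (tabulate∘lookup; tabulate-cong)
  open import Data.Fin.Properties using (fromℕ≢inject₁)
  open import Relation.Binary.PropositionalEquality

  last : ∀ {m} → Fin (suc m)
  last {m} = fromℕ m

  last≢inject₁ : ∀ {m} (i : Fin m) → last ≢ inject₁ i
  last≢inject₁ i = fromℕ≢inject₁

  data LastView {m : ℕ} : Fin (suc m) → Set where
    at-last   : LastView last
    at-inject : (i : Fin m) → LastView (inject₁ i)

  lastView : ∀ {m} (z : Fin (suc m)) → LastView z
  lastView {zero}  zero    = at-last
  lastView {suc m} zero    = at-inject zero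
  lastView {suc m} (suc z) with lastView z
  ... | at-last     = at-last
  ... | at-inject i = at-inject (suc i)

  lookup-∷ʳ-last : ∀ {A : Set} {m} (xs : Vec A m) x → lookup (xs ∷ʳ x) last ≡ x
  lookup-∷ʳ-last []       x = refl
  lookup-∷ʳ-last (_ ∷ xs) x = lookup-∷ʳ-last xs x

  lookup-∷ʳ-inject₁ : ∀ {A : Set} {m} (xs : Vec A m) x i → lookup (xs ∷ʳ x) (inject₁ i) ≡ lookup xs i
  lookup-∷ʳ-inject₁ (y ∷ xs) x zero    = refl
  lookup-∷ʳ-inject₁ (y ∷ xs) x (suc i) = lookup-∷ʳ-inject₁ xs x i

  lookup-init : ∀ {A : Set} {m} (xs : Vec A (suc m)) i → lookup (init xs) i ≡ lookup xs (inject₁ i)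
  lookup-init (x ∷ y ∷ xs) zero    = refl
  lookup-init (x ∷ y ∷ xs) (suc i) = lookup-init (y ∷ xs) i

  lookup-ext : ∀ {A : Set} {n} (xs ys : Vec A n) → (∀ i → lookup xs i ≡ lookup ys i) → xs ≡ ys
  lookup-ext xs ys xs≗ys = trans (sym (tabulate∘lookup xs)) (trans (tabulate-cong xs≗ys) (tabulate∘lookup ys))

  init-last : ∀ {A : Set} {m} (xs : Vec A (suc m)) → init xs ∷ʳ lookup xs last ≡ xs
  init-last xs = lookup-ext _ xs entry
    where
    entry : ∀ z → lookup (init xs ∷ʳ lookup xs last) z ≡ lookup xs z
    entry z with lastView z
    ... | at-last     = lookup-∷ʳ-last (init xs) _
    ... | at-inject i = trans (lookup-∷ʳ-inject₁ (init xs) _ i) (lookup-init xs i)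


-- Removing the largest point `last = m` from a permutation σ of [m + 1]:
-- the predecessor of `last` is sent directly to σ last.  The result σ⁻ is a
-- permutation of [m] with the same cycles (minus `last`) and the same cycle
-- minima; a colouring restricts along.
module RemoveLast where

  open Permutations
  open Reflection
  open MixedCount using (IsColouring)
  open import Data.Nat
  open import Data.Nat.Properties
  open import Data.Bool using (T)
  open import Data.Fin using (Fin; toℕ; inject₁; lower₁)
  import Data.Fin.Properties as Fin
  open import Data.Vec using (Vec; lookup; tabulate; init)
  open import Data.Vec.Properties using (lookup∘tabulate)
  open Snoc using (last; last≢inject₁; lookup-init)
  open import Data.Product using (Σ; _×_; _,_)
  open import Data.Sum using (_⊎_; inj₁; inj₂)
  open import Data.Empty using (⊥-elim)
  open import Relation.Nullary using (yes; no)
  open import Relation.Binary.PropositionalEquality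

  module Removed {m : ℕ} (σ : Vec (Fin (suc m)) (suc m)) (σ-perm : IsPermutation σ) where

    skip : Fin (suc m) → Fin (suc m)
    skip z with lookup σ z Fin.≟ last
    ... | yes _ = lookup σ last
    ... | no  _ = lookup σ z

    skip-pred : ∀ z → lookup σ z ≡ last → skip z ≡ lookup σ last
    skip-pred z σz≡last with lookup σ z Fin.≟ last
    ... | yes _        = refl
    ... | no  σz≢last = ⊥-elim (σz≢last σz≡last)

    skip-other : ∀ z → lookup σ z ≢ last → skip z ≡ lookup σ z
    skip-other z σz≢last with lookup σ z Fin.≟ last
    ... | yes σz≡last = ⊥-elim (σz≢last σz≡last)
    ... | no  _       = refl

    lowerable : ∀ {z} → z ≢ last → m ≢ toℕ z
    lowerable z≢last m≡z = z≢last (Fin.toℕ-injective (trans (sym m≡z) (sym (Fin.toℕ-fromℕ m))))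

    skip≢last : ∀ i → skip (inject₁ i) ≢ last
    skip≢last i with lookup σ (inject₁ i) Fin.≟ last
    ... | yes σi≡last = λ σlast≡last → last≢inject₁ i (sym (σ-perm _ _ (trans σi≡last (sym σlast≡last))))
    ... | no  σi≢last = σi≢last

    σ⁻ : Vec (Fin m) m
    σ⁻ = tabulate (λ i → lower₁ (skip (inject₁ i)) (lowerable (skip≢last i)))

    inject-σ⁻ : ∀ i → inject₁ (lookup σ⁻ i) ≡ skip (inject₁ i)
    inject-σ⁻ i = trans (cong inject₁ (lookup∘tabulate _ i)) (Fin.inject₁-lower₁ _ _)

    σ⁻-perm : IsPermutation σ⁻
    σ⁻-perm i j σ⁻i≡σ⁻j =
      Fin.inject₁-injective (skip-injective
        (trans (sym (inject-σ⁻ i)) (trans (cong inject₁ σ⁻i≡σ⁻j) (inject-σ⁻ j))))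
      where
      skip-injective : skip (inject₁ i) ≡ skip (inject₁ j) → inject₁ i ≡ inject₁ j
      skip-injective eq with lookup σ (inject₁ i) Fin.≟ last | lookup σ (inject₁ j) Fin.≟ last
      ... | yes σi≡last | yes σj≡last = σ-perm _ _ (trans σi≡last (sym σj≡last))
      ... | yes _       | no  _       = ⊥-elim (last≢inject₁ j (σ-perm _ _ eq))
      ... | no  _       | yes _       = ⊥-elim (last≢inject₁ i (σ-perm _ _ (sym eq)))
      ... | no  _       | no  _       = σ-perm _ _ eq

    init-colouring : ∀ {k} (c : Vec (Fin k) (suc m)) → IsColouring σ c → IsColouring σ⁻ (init c)
    init-colouring c c-col i = begin
      lookup (init c) (lookup σ⁻ i)     ≡⟨ lookup-init c (lookup σ⁻ i) ⟩
      lookup c (inject₁ (lookup σ⁻ i))  ≡⟨ cong (lookup c) (inject-σ⁻ i) ⟩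
      lookup c (skip (inject₁ i))       ≡⟨ skip-colour (inject₁ i) ⟩
      lookup c (inject₁ i)              ≡⟨ lookup-init c i ⟨
      lookup (init c) i                 ∎
      where
      open ≡-Reasoning
      skip-colour : ∀ z → lookup c (skip z) ≡ lookup c z
      skip-colour z with lookup σ z Fin.≟ last
      ... | yes σz≡last = trans (c-col last) (trans (cong (lookup c) (sym σz≡last)) (c-col z))
      ... | no  _       = c-col z

    σ⁻-orbit⊆σ-orbit : ∀ i j → Σ ℕ (λ j′ → inject₁ (iter σ⁻ j i) ≡ iter σ j′ (inject₁ i))
    σ⁻-orbit⊆σ-orbit i zero = 0 , refl
    σ⁻-orbit⊆σ-orbit i (suc j) with σ⁻-orbit⊆σ-orbit i j
    ... | j′ , eq with lookup σ (iter σ j′ (inject₁ i)) Fin.≟ last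
    ...   | yes σz≡last = suc (suc j′) ,
            trans (inject-σ⁻ _) (trans (cong skip eq)
                  (trans (skip-pred _ σz≡last) (cong (lookup σ) (sym σz≡last))))
    ...   | no  σz≢last = suc j′ , trans (inject-σ⁻ _) (trans (cong skip eq) (skip-other _ σz≢last))

    σ-orbit⊆σ⁻-orbit : ∀ i j →
      Σ ℕ (λ j′ → iter σ j (inject₁ i) ≡ inject₁ (iter σ⁻ j′ i))
      ⊎ (iter σ j (inject₁ i) ≡ last ×
         Σ ℕ (λ j′ → iter σ (suc j) (inject₁ i) ≡ inject₁ (iter σ⁻ j′ i)))
    σ-orbit⊆σ⁻-orbit i zero = inj₁ (0 , refl)
    σ-orbit⊆σ⁻-orbit i (suc j) with σ-orbit⊆σ⁻-orbit i j
    ... | inj₂ (_ , j′ , eq) = inj₁ (j′ , eq)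
    ... | inj₁ (j′ , eq) with lookup σ (inject₁ (iter σ⁻ j′ i)) Fin.≟ last
    ...   | no  σz≢last =
            inj₁ (suc j′ , trans (cong (lookup σ) eq) (trans (sym (skip-other _ σz≢last)) (sym (inject-σ⁻ _))))
    ...   | yes σz≡last = inj₂ (trans (cong (lookup σ) eq) σz≡last , suc j′ ,
            trans (cong (lookup σ) (trans (cong (lookup σ) eq) σz≡last))
                  (trans (sym (skip-pred _ σz≡last)) (sym (inject-σ⁻ _))))

    cycleMin-restrict : ∀ i → IsCycleMin σ (inject₁ i) → IsCycleMin σ⁻ i
    cycleMin-restrict i i-min j with σ⁻-orbit⊆σ-orbit i j
    ... | j′ , eq =
      subst₂ _≤_ (Fin.toℕ-inject₁ i) (trans (cong toℕ (sym eq)) (Fin.toℕ-inject₁ _)) (i-min j′)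

    cycleMin-extend : ∀ i → IsCycleMin σ⁻ i → IsCycleMin σ (inject₁ i)
    cycleMin-extend i i-min j with σ-orbit⊆σ⁻-orbit i j
    ... | inj₁ (j′ , eq) =
          subst₂ _≤_ (sym (Fin.toℕ-inject₁ i)) (trans (sym (Fin.toℕ-inject₁ _)) (cong toℕ (sym eq)))
                 (i-min j′)
    ... | inj₂ (eq , _) =
          subst (toℕ (inject₁ i) ≤_) (sym (trans (cong toℕ eq) (Fin.toℕ-fromℕ m)))
                (≤-trans (≤-reflexive (Fin.toℕ-inject₁ i)) (<⇒≤ (Fin.toℕ<n i)))

    isCycleMin-σ⁻ : ∀ i → isCycleMin σ (inject₁ i) ≡ isCycleMin σ⁻ i
    isCycleMin-σ⁻ i = T-ext
      (λ h → ⇒isCycleMin σ⁻ i (cycleMin-restrict i (isCycleMin⇒ σ σ-perm _ h)))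
      (λ h → ⇒isCycleMin σ (inject₁ i) (cycleMin-extend i (isCycleMin⇒ σ⁻ σ⁻-perm i h)))

    fixed⇒isCycleMin : lookup σ last ≡ last → T (isCycleMin σ last)
    fixed⇒isCycleMin σlast≡last = ⇒isCycleMin σ last (λ j → ≤-reflexive (cong toℕ (sym (iter-fixed j))))
      where
      iter-fixed : ∀ j → iter σ j last ≡ last
      iter-fixed zero    = refl
      iter-fixed (suc j) = trans (cong (lookup σ) (iter-fixed j)) σlast≡last

    isCycleMin⇒fixed : T (isCycleMin σ last) → lookup σ last ≡ last
    isCycleMin⇒fixed h = Fin.toℕ-injective (≤-antisym
      (≤-trans (≤-pred (Fin.toℕ<n (lookup σ last))) (≤-reflexive (sym (Fin.toℕ-fromℕ m))))
      (isCycleMin⇒ σ σ-perm last h 1))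

    predecessor : lookup σ last ≢ last → Σ (Fin m) (λ y → lookup σ (inject₁ y) ≡ last)
    predecessor σlast≢last with period σ σ-perm last
    ... | suc q , _ , _ , σ¹⁺ᵠlast≡last =
      lower₁ z (lowerable z≢last) ,
      trans (cong (lookup σ) (Fin.inject₁-lower₁ z (lowerable z≢last))) σ¹⁺ᵠlast≡last
      where
      z = iter σ q last
      z≢last : z ≢ last
      z≢last z≡last = σlast≢last (trans (cong (lookup σ) (sym z≡last)) σ¹⁺ᵠlast≡last)


-- How the cycle counts of (σ, c) relate to those of (σ⁻, init c): the only
-- cycle that can disappear is the fixed point `last`.
module CycleCounts where

  open Sums using (sumFin; sumFin-last; sumFin-cong)
  open Counting using (indicator)
  open Requirements
  open Permutations using (IsPermutation)
  open Reflection
  open MixedCount using (HasCycleCounts)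
  open import Data.Nat using (ℕ; suc; pred; _+_)
  open import Data.Nat.Properties using (+-identityʳ; +-comm)
  open import Data.Bool using (Bool; true; false; _∧_)
  open import Data.Fin using (Fin; inject₁)
  open import Data.Fin.Properties using (_≟_)
  open import Data.Vec using (Vec; lookup; init)
  open import Data.Product using (_×_; _,_)
  open import Data.Empty using (⊥-elim)
  open import Relation.Nullary using (yes; no)
  open import Relation.Binary.PropositionalEquality
  open import Function using (_∘_)
  open Snoc using (last; lookup-init)

  decrease+indicator : ∀ {k} (a : Fin k) r {u} → r a ≡ suc u →
    ∀ b → decrease a r b + indicator (eqF a b) ≡ r b
  decrease+indicator a r {u} ra≡1+u b with a ≟ b
  ... | yes refl = trans (cong (_+ 1) (trans (decrease-self a r) (cong pred ra≡1+u))) (trans (+-comm u 1) (sym ra≡1+u))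
  ... | no  a≢b  = trans (+-identityʳ _) (decrease-other a b r a≢b)

  +indicator⇒decrease : ∀ {k} (a : Fin k) r (C : Fin k → ℕ) → (∀ b → C b + indicator (eqF a b) ≡ r b) →
    Positive (r a) × (∀ b → C b ≡ decrease a r b)
  +indicator⇒decrease a r C C+[a]≡r = (C a , ra≡1+Ca) , C≡decrease
    where
    ra≡1+Ca : r a ≡ suc (C a)
    ra≡1+Ca = trans (sym (C+[a]≡r a)) (trans (cong (λ v → C a + indicator v) (eqF-refl a)) (+-comm (C a) 1))
    C≡decrease : ∀ b → C b ≡ decrease a r b
    C≡decrease b with a ≟ b
    ... | yes refl = sym (trans (decrease-self a r) (cong pred ra≡1+Ca))
    ... | no  a≢b  = begin
      C b                            ≡⟨ +-identityʳ (C b) ⟨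
      C b + 0                        ≡⟨ cong (λ v → C b + indicator v) (eqF-≢ a≢b) ⟨
      C b + indicator (eqF a b)      ≡⟨ C+[a]≡r b ⟩
      r b                            ≡⟨ decrease-other a b r a≢b ⟨
      decrease a r b                 ∎
      where open ≡-Reasoning

  module _ {m k : ℕ} (σ : Vec (Fin (suc m)) (suc m)) (σ-perm : IsPermutation σ) (c : Vec (Fin k) (suc m)) where

    open RemoveLast.Removed σ σ-perm

    cyclesOfColour-split : ∀ a → cyclesOfColour σ c a
      ≡ cyclesOfColour σ⁻ (init c) a + indicator (isCycleMin σ last ∧ eqF (lookup c last) a)
    cyclesOfColour-split a = begin
      cyclesOfColour σ c a
        ≡⟨ countF≡sumFin counted ⟩
      sumFin (suc m) (indicator ∘ counted)
        ≡⟨ sumFin-last m (indicator ∘ counted) ⟩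
      sumFin m (indicator ∘ counted ∘ inject₁) + indicator (counted last)
        ≡⟨ cong (_+ indicator (counted last)) (sumFin-cong m (cong indicator ∘ restrict)) ⟩
      sumFin m (indicator ∘ counted⁻) + indicator (counted last)
        ≡⟨ cong (_+ indicator (counted last)) (countF≡sumFin counted⁻) ⟨
      cyclesOfColour σ⁻ (init c) a + indicator (counted last) ∎
      where
      open ≡-Reasoning
      counted : Fin (suc m) → Bool
      counted z = isCycleMin σ z ∧ eqF (lookup c z) a
      counted⁻ : Fin m → Bool
      counted⁻ i = isCycleMin σ⁻ i ∧ eqF (lookup (init c) i) a
      restrict : ∀ i → counted (inject₁ i) ≡ counted⁻ i
      restrict i = cong₂ (λ u v → u ∧ eqF v a) (isCycleMin-σ⁻ i) (sym (lookup-init c i))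

    moved-counts : lookup σ last ≢ last → ∀ a → cyclesOfColour σ c a ≡ cyclesOfColour σ⁻ (init c) a
    moved-counts σlast≢last a = begin
      cyclesOfColour σ c a
        ≡⟨ cyclesOfColour-split a ⟩
      cyclesOfColour σ⁻ (init c) a + indicator (isCycleMin σ last ∧ eqF (lookup c last) a)
        ≡⟨ cong (λ v → cyclesOfColour σ⁻ (init c) a + indicator (v ∧ eqF (lookup c last) a)) not-min ⟩
      cyclesOfColour σ⁻ (init c) a + 0
        ≡⟨ +-identityʳ _ ⟩
      cyclesOfColour σ⁻ (init c) a ∎
      where
      open ≡-Reasoning
      not-min : isCycleMin σ last ≡ false
      not-min = T-ext (λ h → ⊥-elim (σlast≢last (isCycleMin⇒fixed h))) (λ ())

    fixed-counts : lookup σ last ≡ last →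
      ∀ a → cyclesOfColour σ c a ≡ cyclesOfColour σ⁻ (init c) a + indicator (eqF (lookup c last) a)
    fixed-counts σlast≡last a =
      trans (cyclesOfColour-split a)
            (cong (λ v → cyclesOfColour σ⁻ (init c) a + indicator (v ∧ eqF (lookup c last) a)) is-min)
      where
      is-min : isCycleMin σ last ≡ true
      is-min = T-ext (λ _ → _) (λ _ → fixed⇒isCycleMin σlast≡last)

    fixed-counts⇒ : lookup σ last ≡ last → ∀ r → HasCycleCounts r σ c →
      Positive (r (lookup c last)) × HasCycleCounts (decrease (lookup c last) r) σ⁻ (init c)
    fixed-counts⇒ σlast≡last r counts =
      +indicator⇒decrease (lookup c last) r _ (λ b → trans (sym (fixed-counts σlast≡last b)) (counts b))

    fixed-counts⇐ : lookup σ last ≡ last → ∀ r → Positive (r (lookup c last)) →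
      HasCycleCounts (decrease (lookup c last) r) σ⁻ (init c) → HasCycleCounts r σ c
    fixed-counts⇐ σlast≡last r (u , ra≡1+u) counts⁻ b =
      trans (fixed-counts σlast≡last b)
            (trans (cong (_+ indicator (eqF (lookup c last) b)) (counts⁻ b))
                   (decrease+indicator (lookup c last) r ra≡1+u b))


module InsertLast where

  open Permutations using (IsPermutation)
  open MixedCount using (IsColouring)
  open Snoc
  open RemoveLast using (module Removed)
  open import Data.Nat using (ℕ; suc)
  open import Data.Fin using (Fin; inject₁)
  import Data.Fin.Properties as Fin
  open import Data.Vec using (Vec; lookup; _∷ʳ_; _[_]≔_)
  import Data.Vec as Vec
  open import Data.Vec.Properties using (lookup-map; lookup∘update; lookup∘update′)
  open import Data.Empty using (⊥-elim)
  open import Relation.Nullary using (yes; no)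
  open import Relation.Binary.PropositionalEquality

  module _ {m : ℕ} where

    insertFixed : Vec (Fin m) m → Vec (Fin (suc m)) (suc m)
    insertFixed σ = Vec.map inject₁ σ ∷ʳ last

    redirect : Fin m → Vec (Fin m) m → Vec (Fin (suc m)) m
    redirect y σ = Vec.map inject₁ σ [ y ]≔ last

    insertAfter : Fin m → Vec (Fin m) m → Vec (Fin (suc m)) (suc m)
    insertAfter y σ = redirect y σ ∷ʳ inject₁ (lookup σ y)

    insertFixed-last : ∀ σ → lookup (insertFixed σ) last ≡ last
    insertFixed-last σ = lookup-∷ʳ-last (Vec.map inject₁ σ) last

    insertFixed-inject : ∀ σ i → lookup (insertFixed σ) (inject₁ i) ≡ inject₁ (lookup σ i)
    insertFixed-inject σ i = trans (lookup-∷ʳ-inject₁ (Vec.map inject₁ σ) last i) (lookup-map i inject₁ σ)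

    insertAfter-last : ∀ y σ → lookup (insertAfter y σ) last ≡ inject₁ (lookup σ y)
    insertAfter-last y σ = lookup-∷ʳ-last (redirect y σ) _

    insertAfter-y : ∀ y σ → lookup (insertAfter y σ) (inject₁ y) ≡ last
    insertAfter-y y σ =
      trans (lookup-∷ʳ-inject₁ (redirect y σ) _ y) (lookup∘update y (Vec.map inject₁ σ) last)

    insertAfter-other : ∀ y σ i → i ≢ y → lookup (insertAfter y σ) (inject₁ i) ≡ inject₁ (lookup σ i)
    insertAfter-other y σ i i≢y =
      trans (lookup-∷ʳ-inject₁ (redirect y σ) _ i)
            (trans (lookup∘update′ i≢y (Vec.map inject₁ σ) last) (lookup-map i inject₁ σ))

    insertFixed-perm : ∀ σ → IsPermutation σ → IsPermutation (insertFixed σ)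
    insertFixed-perm σ σ-perm z w eq with lastView z | lastView w
    ... | at-last     | at-last     = refl
    ... | at-last     | at-inject j =
          ⊥-elim (last≢inject₁ _ (trans (sym (insertFixed-last σ)) (trans eq (insertFixed-inject σ j))))
    ... | at-inject i | at-last     =
          ⊥-elim (last≢inject₁ _ (trans (sym (insertFixed-last σ)) (trans (sym eq) (insertFixed-inject σ i))))
    ... | at-inject i | at-inject j = cong inject₁ (σ-perm i j (Fin.inject₁-injective
          (trans (sym (insertFixed-inject σ i)) (trans eq (insertFixed-inject σ j)))))

    not-image-of-last : ∀ y σ → IsPermutation σ → ∀ j →
      lookup (insertAfter y σ) (inject₁ j) ≢ inject₁ (lookup σ y)
    not-image-of-last y σ σ-perm j eq with j Fin.≟ y
    ... | yes refl = last≢inject₁ _ (trans (sym (insertAfter-y y σ)) eq)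
    ... | no  j≢y  = j≢y (σ-perm j y (Fin.inject₁-injective (trans (sym (insertAfter-other y σ j j≢y)) eq)))

    insertAfter-perm : ∀ y σ → IsPermutation σ → IsPermutation (insertAfter y σ)
    insertAfter-perm y σ σ-perm z w eq with lastView z | lastView w
    ... | at-last     | at-last     = refl
    ... | at-last     | at-inject j = ⊥-elim (not-image-of-last y σ σ-perm j (trans (sym eq) (insertAfter-last y σ)))
    ... | at-inject i | at-last     = ⊥-elim (not-image-of-last y σ σ-perm i (trans eq (insertAfter-last y σ)))
    ... | at-inject i | at-inject j = cong inject₁ (on-inject i j eq)
      where
      on-inject : ∀ i j → lookup (insertAfter y σ) (inject₁ i) ≡ lookup (insertAfter y σ) (inject₁ j) → i ≡ j
      on-inject i j eq with i Fin.≟ y | j Fin.≟ y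
      ... | yes i≡y | yes j≡y = trans i≡y (sym j≡y)
      ... | yes refl | no j≢y =
            ⊥-elim (last≢inject₁ _ (trans (sym (insertAfter-y y σ)) (trans eq (insertAfter-other y σ j j≢y))))
      ... | no i≢y | yes refl =
            ⊥-elim (last≢inject₁ _
              (trans (sym (insertAfter-y y σ)) (trans (sym eq) (insertAfter-other y σ i i≢y))))
      ... | no i≢y | no j≢y = σ-perm i j (Fin.inject₁-injective
            (trans (sym (insertAfter-other y σ i i≢y)) (trans eq (insertAfter-other y σ j j≢y))))

    insertFixed-colouring : ∀ {k} σ (c : Vec (Fin k) m) a →
      IsColouring σ c → IsColouring (insertFixed σ) (c ∷ʳ a)
    insertFixed-colouring σ c a c-col z with lastView z
    ... | at-last     = cong (lookup (c ∷ʳ a)) (insertFixed-last σ)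
    ... | at-inject i = begin
      lookup (c ∷ʳ a) (lookup (insertFixed σ) (inject₁ i))  ≡⟨ cong (lookup (c ∷ʳ a)) (insertFixed-inject σ i) ⟩
      lookup (c ∷ʳ a) (inject₁ (lookup σ i))                ≡⟨ lookup-∷ʳ-inject₁ c a _ ⟩
      lookup c (lookup σ i)                                 ≡⟨ c-col i ⟩
      lookup c i                                            ≡⟨ lookup-∷ʳ-inject₁ c a i ⟨
      lookup (c ∷ʳ a) (inject₁ i)                           ∎
      where open ≡-Reasoning

    -- `last` joins the cycle of y, so it takes the colour of y.
    insertAfter-colouring : ∀ {k} y σ (c : Vec (Fin k) m) →
      IsColouring σ c → IsColouring (insertAfter y σ) (c ∷ʳ lookup c y)
    insertAfter-colouring y σ c c-col z with lastView z
    ... | at-last     = begin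
      lookup c′ (lookup (insertAfter y σ) last)  ≡⟨ cong (lookup c′) (insertAfter-last y σ) ⟩
      lookup c′ (inject₁ (lookup σ y))           ≡⟨ lookup-∷ʳ-inject₁ c _ _ ⟩
      lookup c (lookup σ y)                      ≡⟨ c-col y ⟩
      lookup c y                                 ≡⟨ lookup-∷ʳ-last c _ ⟨
      lookup c′ last                             ∎
      where open ≡-Reasoning
            c′ = c ∷ʳ lookup c y
    ... | at-inject i with i Fin.≟ y
    ...   | yes refl = trans (cong (lookup c′) (insertAfter-y y σ))
                             (trans (lookup-∷ʳ-last c _) (sym (lookup-∷ʳ-inject₁ c _ y)))
      where c′ = c ∷ʳ lookup c y
    ...   | no  i≢y  = begin
      lookup c′ (lookup (insertAfter y σ) (inject₁ i))  ≡⟨ cong (lookup c′) (insertAfter-other y σ i i≢y) ⟩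
      lookup c′ (inject₁ (lookup σ i))                  ≡⟨ lookup-∷ʳ-inject₁ c _ _ ⟩
      lookup c (lookup σ i)                             ≡⟨ c-col i ⟩
      lookup c i                                        ≡⟨ lookup-∷ʳ-inject₁ c _ i ⟨
      lookup c′ (inject₁ i)                             ∎
      where open ≡-Reasoning
            c′ = c ∷ʳ lookup c y

    remove-insertFixed : ∀ σ (P : IsPermutation (insertFixed σ)) → Removed.σ⁻ (insertFixed σ) P ≡ σ
    remove-insertFixed σ P = lookup-ext _ σ (λ i → Fin.inject₁-injective (begin
      inject₁ (lookup (Removed.σ⁻ (insertFixed σ) P) i)  ≡⟨ Removed.inject-σ⁻ (insertFixed σ) P i ⟩
      Removed.skip (insertFixed σ) P (inject₁ i)         ≡⟨ Removed.skip-other (insertFixed σ) P _ (moved i) ⟩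
      lookup (insertFixed σ) (inject₁ i)                 ≡⟨ insertFixed-inject σ i ⟩
      inject₁ (lookup σ i)                               ∎))
      where
      open ≡-Reasoning
      moved : ∀ i → lookup (insertFixed σ) (inject₁ i) ≢ last
      moved i eq = last≢inject₁ _ (trans (sym eq) (insertFixed-inject σ i))

    remove-insertAfter : ∀ y σ (P : IsPermutation (insertAfter y σ)) → Removed.σ⁻ (insertAfter y σ) P ≡ σ
    remove-insertAfter y σ P = lookup-ext _ σ (λ i →
      Fin.inject₁-injective (trans (Removed.inject-σ⁻ (insertAfter y σ) P i) (skipped i)))
      where
      skipped : ∀ i → Removed.skip (insertAfter y σ) P (inject₁ i) ≡ inject₁ (lookup σ i)
      skipped i with i Fin.≟ y
      ... | yes refl = trans (Removed.skip-pred (insertAfter y σ) P _ (insertAfter-y y σ)) (insertAfter-last y σ)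
      ... | no  i≢y  = trans (Removed.skip-other (insertAfter y σ) P _ moved) (insertAfter-other y σ i i≢y)
        where
        moved : lookup (insertAfter y σ) (inject₁ i) ≢ last
        moved eq = last≢inject₁ _ (trans (sym eq) (insertAfter-other y σ i i≢y))

    insertFixed-remove : ∀ (σ : Vec (Fin (suc m)) (suc m)) (P : IsPermutation σ) →
      lookup σ last ≡ last → insertFixed (Removed.σ⁻ σ P) ≡ σ
    insertFixed-remove σ P σlast≡last = lookup-ext _ σ entry
      where
      σ⁻ = Removed.σ⁻ σ P
      entry : ∀ z → lookup (insertFixed (Removed.σ⁻ σ P)) z ≡ lookup σ z
      entry z with lastView z
      ... | at-last     = trans (insertFixed-last σ⁻) (sym σlast≡last)
      ... | at-inject i = trans (insertFixed-inject σ⁻ i) (trans (Removed.inject-σ⁻ σ P i)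
            (Removed.skip-other σ P (inject₁ i) (λ eq → last≢inject₁ i (P _ _ (trans σlast≡last (sym eq))))))

    insertAfter-remove : ∀ (σ : Vec (Fin (suc m)) (suc m)) (P : IsPermutation σ) y →
      lookup σ (inject₁ y) ≡ last → insertAfter y (Removed.σ⁻ σ P) ≡ σ
    insertAfter-remove σ P y σy≡last = lookup-ext _ σ entry
      where
      σ⁻ = Removed.σ⁻ σ P
      entry : ∀ z → lookup (insertAfter y (Removed.σ⁻ σ P)) z ≡ lookup σ z
      entry z with lastView z
      ... | at-last     = trans (insertAfter-last y σ⁻)
            (trans (Removed.inject-σ⁻ σ P y) (Removed.skip-pred σ P (inject₁ y) σy≡last))
      ... | at-inject i with i Fin.≟ y
      ...   | yes refl = trans (insertAfter-y y σ⁻) (sym σy≡last)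
      ...   | no  i≢y  = trans (insertAfter-other y σ⁻ i i≢y) (trans (Removed.inject-σ⁻ σ P i)
              (Removed.skip-other σ P (inject₁ i)
                (λ eq → i≢y (Fin.inject₁-injective (P _ _ (trans eq (sym σy≡last)))))))


-- The bijection behind the recurrence of mixedCount: a mixed coloured
-- permutation of [m + 1] is either one of [m] with `last` inserted after one
-- of the m points, or one of [m] for the requirement lowered at a colour a,
-- with `last` added as a fixed point of colour a.
module Decomposition where

  open Requirements
  open Permutations using (IsPermutation)
  open MixedCount
  open RemoveLast.Removed using (σ⁻; σ⁻-perm; init-colouring; predecessor)
  open CycleCounts
  open InsertLast
  open Snoc using (last; last≢inject₁; lookup-∷ʳ-last; lookup-init; init-last)
  open import Data.Fin using (Fin; inject₁)
  import Data.Fin.Properties as Fin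
  open import Data.Vec using (Vec; lookup; init; _∷ʳ_)
  open import Data.Vec.Properties using (init-∷ʳ)
  open import Data.Product using (Σ; _×_; _,_; proj₁; proj₂)
  open import Data.Sum using (_⊎_; inj₁; inj₂)
  open import Data.Empty using (⊥-elim)
  open import Relation.Nullary using (Dec; yes; no)
  open import Relation.Binary.PropositionalEquality
  open import Function using (_↔_; mk↔ₛ′)

  module _ {m k : ℕ} (r : Fin k → ℕ) where

    Decomposed : Set
    Decomposed = (Fin m × Mixed m k r) ⊎ Σ (Fin k) (λ a → Positive (r a) × Mixed m k (decrease a r))

    mixed : ∀ {n} r′ (p : Vec (Fin n) n × Vec (Fin k) n) → IsMixedFor r′ p → Mixed n k r′
    mixed r′ p h = p , ⇒isMixedFor r′ p h

    remove-moved : ∀ (σ : Vec (Fin (suc m)) (suc m)) c → lookup σ last ≢ last → (mixed : IsMixedFor r (σ , c)) →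
      IsMixedFor r (σ⁻ σ (proj₁ mixed) , init c)
    remove-moved σ c moved (P , colouring , counts) =
      σ⁻-perm σ P , init-colouring σ P c colouring , λ a → trans (sym (moved-counts σ P c moved a)) (counts a)

    remove-fixed : ∀ (σ : Vec (Fin (suc m)) (suc m)) c → lookup σ last ≡ last → (mixed : IsMixedFor r (σ , c)) →
      Positive (r (lookup c last)) × IsMixedFor (decrease (lookup c last) r) (σ⁻ σ (proj₁ mixed) , init c)
    remove-fixed σ c fixed (P , colouring , counts) with fixed-counts⇒ σ P c fixed r counts
    ... | positive , counts⁻ = positive , σ⁻-perm σ P , init-colouring σ P c colouring , counts⁻

    insert-moved : ∀ y (σ : Vec (Fin m) m) c →
      IsMixedFor r (σ , c) → IsMixedFor r (insertAfter y σ , c ∷ʳ lookup c y)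
    insert-moved y σ c (P , colouring , counts) =
      P̂ , insertAfter-colouring y σ c colouring , λ a →
        trans (moved-counts (insertAfter y σ) P̂ (c ∷ʳ lookup c y) moved a)
              (trans (cong₂ (λ σ′ c′ → cyclesOfColour σ′ c′ a) (remove-insertAfter y σ P̂) (init-∷ʳ _ c))
                     (counts a))
      where
      P̂ = insertAfter-perm y σ P
      moved : lookup (insertAfter y σ) last ≢ last
      moved eq = last≢inject₁ _ (trans (sym eq) (insertAfter-last y σ))

    insert-fixed : ∀ a (σ : Vec (Fin m) m) c → Positive (r a) → IsMixedFor (decrease a r) (σ , c) →
      IsMixedFor r (insertFixed σ , c ∷ʳ a)
    insert-fixed a σ c positive (P , colouring , counts) =
      P̂ , insertFixed-colouring σ c a colouring ,
      fixed-counts⇐ (insertFixed σ) P̂ (c ∷ʳ a) (insertFixed-last σ) r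
        (subst (λ a′ → Positive (r a′)) (sym (lookup-∷ʳ-last c a)) positive)
        (subst₂ (λ a′ (p : Vec (Fin m) m × Vec (Fin k) m) → HasCycleCounts (decrease a′ r) (proj₁ p) (proj₂ p))
                (sym (lookup-∷ʳ-last c a)) (sym (cong₂ _,_ (remove-insertFixed σ P̂) (init-∷ʳ a c)))
                counts)
      where
      P̂ = insertFixed-perm σ P

    removeWith : ∀ (σ : Vec (Fin (suc m)) (suc m)) c →
      IsMixedFor r (σ , c) → Dec (lookup σ last ≡ last) → Decomposed
    removeWith σ c h (yes fixed) =
      inj₂ (lookup c last , proj₁ lowered ,
            mixed (decrease (lookup c last) r) (σ⁻ σ (proj₁ h) , init c) (proj₂ lowered))
      where lowered = remove-fixed σ c fixed h
    removeWith σ c h (no  moved) =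
      inj₁ (proj₁ (predecessor σ (proj₁ h) moved) ,
            mixed r (σ⁻ σ (proj₁ h) , init c) (remove-moved σ c moved h))

    remove : Mixed (suc m) k r → Decomposed
    remove ((σ , c) , h) = removeWith σ c (isMixedFor⇒ r (σ , c) h) (lookup σ last Fin.≟ last)

    insert : Decomposed → Mixed (suc m) k r
    insert (inj₁ (y , (σ , c) , h)) =
      mixed r (insertAfter y σ , c ∷ʳ lookup c y) (insert-moved y σ c (isMixedFor⇒ r (σ , c) h))
    insert (inj₂ (a , positive , (σ , c) , h)) =
      mixed r (insertFixed σ , c ∷ʳ a) (insert-fixed a σ c positive (isMixedFor⇒ (decrease a r) (σ , c) h))

    insert-remove : ∀ v → insert (remove v) ≡ v
    insert-remove ((σ , c) , h) with lookup σ last Fin.≟ last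
    ... | yes fixed = Mixed-≡ (cong₂ _,_ (insertFixed-remove σ P fixed) (init-last c))
      where P = proj₁ (isMixedFor⇒ r (σ , c) h)
    ... | no  moved =
      Mixed-≡ (cong₂ _,_ (insertAfter-remove σ P y σy≡last) (trans (cong (init c ∷ʳ_) colour-y) (init-last c)))
      where
      H = isMixedFor⇒ r (σ , c) h
      P = proj₁ H
      y = proj₁ (predecessor σ P moved)
      σy≡last = proj₂ (predecessor σ P moved)
      -- y and its successor `last` lie on the same cycle, hence share a colour.
      colour-y : lookup (init c) y ≡ lookup c last
      colour-y = trans (lookup-init c y) (trans (sym (proj₁ (proj₂ H) (inject₁ y))) (cong (lookup c) σy≡last))

    predecessor-unique : ∀ (σ : Vec (Fin (suc m)) (suc m)) (P : IsPermutation σ) moved y →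
      lookup σ (inject₁ y) ≡ last → proj₁ (predecessor σ P moved) ≡ y
    predecessor-unique σ P moved y σy≡last =
      Fin.inject₁-injective (P _ _ (trans (proj₂ (predecessor σ P moved)) (sym σy≡last)))

    inj₂-≡ : ∀ {a a′} → a ≡ a′ → ∀ {positive positive′ p p′ h h′} → p ≡ p′ →
      _≡_ {A = Decomposed} (inj₂ (a , positive , (p , h))) (inj₂ (a′ , positive′ , (p′ , h′)))
    inj₂-≡ refl refl = cong (λ q → inj₂ (_ , q)) (cong₂ _,_ (Positive-irrelevant _ _) (Mixed-≡ refl))

    removeWith-insertAfter : ∀ y σ c h H d →
      removeWith (insertAfter y σ) (c ∷ʳ lookup c y) H d ≡ inj₁ (y , ((σ , c) , h))
    removeWith-insertAfter y σ c h H (yes fixed) =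
      ⊥-elim (last≢inject₁ _ (trans (sym fixed) (insertAfter-last y σ)))
    removeWith-insertAfter y σ c h H (no  moved) = cong inj₁ (cong₂ _,_
      (predecessor-unique (insertAfter y σ) (proj₁ H) moved y (insertAfter-y y σ))
      (Mixed-≡ (cong₂ _,_ (remove-insertAfter y σ (proj₁ H)) (init-∷ʳ _ c))))

    removeWith-insertFixed : ∀ a positive σ c h H d →
      removeWith (insertFixed σ) (c ∷ʳ a) H d ≡ inj₂ (a , positive , ((σ , c) , h))
    removeWith-insertFixed a positive σ c h H (yes fixed) =
      inj₂-≡ (lookup-∷ʳ-last c a) (cong₂ _,_ (remove-insertFixed σ (proj₁ H)) (init-∷ʳ a c))
    removeWith-insertFixed a positive σ c h H (no  moved) = ⊥-elim (moved (insertFixed-last σ))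

    remove-insert : ∀ w → remove (insert w) ≡ w
    remove-insert (inj₁ (y , (σ , c) , h))            = removeWith-insertAfter y σ c h _ _
    remove-insert (inj₂ (a , positive , (σ , c) , h)) = removeWith-insertFixed a positive σ c h _ _

    Mixed-suc-↔ : Mixed (suc m) k r ↔ Decomposed
    Mixed-suc-↔ = mk↔ₛ′ remove insert remove-insert insert-remove


module Recurrence where

  open Sums
  open Requirements
  open Counting
  open MixedCount
  open import Data.Nat
  open import Data.Nat.Properties using (+-identityʳ)
  open import Data.Bool using (true; _∧_)
  open import Data.Fin using (Fin; zero; suc)
  open import Data.Fin.Properties using (+↔⊎; *↔×)
  open import Data.Fin.Permutation using (↔⇒≡)
  open import Data.List using (foldr; tabulate; cartesianProduct)
  open import Data.Product using (_×_; _,_)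
  open import Data.Product.Function.Dependent.Propositional using (Σ-↔)
  open import Data.Product.Function.NonDependent.Propositional using (_×-↔_)
  open import Data.Sum.Function.Propositional using (_⊎-↔_)
  open import Function using (_∘_; _↔_; mk↔ₛ′)
  open import Function.Properties.Inverse using (↔-refl; ↔-sym; ↔-trans)
  open import Relation.Binary.PropositionalEquality

  Fin-whenPositive : ∀ n N → Fin (whenPositive n N) ↔ (Positive n × Fin N)
  Fin-whenPositive zero    N = mk↔ₛ′ (λ ()) (λ { ((_ , ()) , _) }) (λ { ((_ , ()) , _) }) (λ ())
  Fin-whenPositive (suc n) N = mk↔ₛ′ ((n , refl) ,_) (λ (_ , i) → i)
    (λ { ((_ , refl) , i) → refl }) (λ _ → refl)

  mixedCount-suc : ∀ m k r → mixedCount (suc m) k r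
    ≡ m * mixedCount m k r + sumFin k (λ a → whenPositive (r a) (mixedCount m k (decrease a r)))
  mixedCount-suc m k r = ↔⇒≡ (
    ↔-trans (Fin-mixedCount (suc m) k r)
    (↔-trans (Decomposition.Mixed-suc-↔ r)
    (↔-trans ((↔-refl ×-↔ ↔-sym (Fin-mixedCount m k r))
              ⊎-↔ Σ-↔ ↔-refl (λ {a} → ↔-refl ×-↔ ↔-sym (Fin-mixedCount m k (decrease a r))))
    (↔-trans (↔-sym *↔× ⊎-↔ Σ-↔ ↔-refl (λ {a} → ↔-sym (Fin-whenPositive (r a) _)))
    (↔-trans (↔-refl ⊎-↔ ↔-sym (Fin-sumFin k _))
    (↔-sym +↔⊎))))))

  -- Only the empty permutation of [0] remains; it has no cycles, so it
  -- qualifies exactly when every requirement is 0.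
  mixedCount-zero : ∀ k r → mixedCount 0 k r ≡ isZero (sumFin k r)
  mixedCount-zero k r = trans (length-filter (isMixedFor r) (cartesianProduct (allVecs 0 0) (allVecs 0 k)))
    (trans (+-identityʳ _) (all-zero k (λ a → a)))
    where
    all-zero : ∀ n (h : Fin n → Fin k) →
      indicator (foldr (λ a b → (0 ≡ᵇ r a) ∧ b) true (tabulate h)) ≡ isZero (sumFin n (r ∘ h))
    all-zero zero    h = refl
    all-zero (suc n) h with r (h zero)
    ... | zero  = all-zero n (h ∘ suc)
    ... | suc _ = refl


-- The closed form of the mixed Stirling numbers:
--   t! · [m, (k + 1)/t] = (t + k)! · stirling m (t + k),
-- the requirement vector required t having total t + k and factorial product t!.
module MixedStirling where

  open Sums
  open Stirling using (stirling)
  open MixedCount using (mixedCount)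
  open Recurrence
  open import Data.Nat
  open import Data.Nat.Properties using (*-identityˡ; *-identityʳ)
  open import Relation.Binary.PropositionalEquality

  sum-ones : ∀ k → sumFin k (λ _ → 1) ≡ k
  sum-ones zero    = refl
  sum-ones (suc k) = cong suc (sum-ones k)

  product-ones : ∀ k → prodFin k (λ _ → 1) ≡ 1
  product-ones zero    = refl
  product-ones (suc k) = trans (*-identityˡ _) (product-ones k)

  mixedStirling-closed : ∀ m k t → t ! * mixedStirling m (suc k) t ≡ (t + k) ! * stirling m (t + k)
  mixedStirling-closed m k t = begin
    t ! * mixedCount m (suc k) (required t)
      ≡⟨ cong (_* mixedCount m (suc k) (required t)) (trans (cong (t ! *_) (product-ones k)) (*-identityʳ (t !))) ⟨
    prodFin (suc k) (λ a → required t a !) * mixedCount m (suc k) (required t)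
      ≡⟨ ClosedForm.closed-form mixedCount mixedCount-zero mixedCount-suc m (suc k) (required t) ⟩
    (t + sumFin k (λ _ → 1)) ! * stirling m (t + sumFin k (λ _ → 1))
      ≡⟨ cong (λ s → (t + s) ! * stirling m (t + s)) (sum-ones k) ⟩
    (t + k) ! * stirling m (t + k) ∎
    where open ≡-Reasoning


-- The theorem, with k = k′ + 1 and t = t′ + 1.
mainTheorem11 : (n k t : ℕ) → 1 ≤ n → 1 ≤ k → 1 ≤ t → k ≤ n → t ≤ n →
    t * mixedStirling n k t
    ≡ sum (map (λ i → (n C suc i) * (i !) * mixedStirling (n ∸ suc i) k (t ∸ 1)) (upTo n))
mainTheorem11 n (suc k′) (suc t′) _ _ _ _ _ =
  FromClosedForm.convolution-identity mixedStirling MixedStirling.mixedStirling-closed n k′ t′
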